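{- Let $\mathcal{L}$ be a first-order alphabet, $P$ a definite clause program over $\mathcal{L}$, and $Q$ an atomic query over $\mathcal{L}$, and let $\mathit{magic}(P,Q)$ be the magic program defined in the context. Define the call-success specification $\langle \mathit{pre},\mathit{post}\rangle$ by $\mathit{pre}=\{A \mid A \text{ an atom over } \mathcal{L},\ \mathit{magic}(P,Q)\models \hat A\}$ and $\mathit{post}=\{A \mid A \text{ an atom over } \mathcal{L},\ \mathit{magic}(P,Q)\models A\}$. Then $P$ with $Q$ is correct w.r.t. $\langle \mathit{pre},\mathit{post}\rangle$: in every LD-derivation for $P$ and $Q$, every procedure call is in $\mathit{pre}$ and every procedure success is in $\mathit{post}$. In particular, each computed answer $Q\theta$ for $P$ and $Q$ is in $\mathit{post}$.
   Context: Magic transformation: the alphabet $\mathcal{L}$ is extended with a new predicate symbol $\hat p$ for each predicate symbol $p$ of $\mathcal{L}$; for each $p$ some $k_p$ argument positions $i_1<\dots<i_{k_p}$ of $p$ are selected, and $\hat p$ has arity $k_p$. For an atom $A=p(t_1,\dots,t_n)$ over $\mathcal{L}$, $\hat A$ denotes $\hat p(t_{i_1},\dots,t_{i_{k_p}})$. The program $\mathit{magic}(P,Q)$ consists of: (1) a clause $H\gets \hat H, B_1,\dots,B_n$ for each clause $H\gets B_1,\dots,B_n$ of $P$; (2) a clause $\hat B_i\gets \hat H, B_1,\dots,B_{i-1}$ for each clause $H\gets B_1,\dots,B_n$ of $P$ and each $i=1,\dots,n$; (3) the unit clause $\hat Q\gets$. LD-resolution is SLD-resolution with the Prolog (leftmost)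 selection rule. A computed answer for $P$ and $Q$ is $Q\theta$ where $\theta$ is the composition of mgu's of a successful SLD-derivation for $P$ and $Q$. For an LD-derivation with queries $Q_0,Q_1,\dots$ and mgu's $\theta_1,\theta_2,\dots$, let $\theta_{i,j}=\theta_{i+1}\cdots\theta_j$ for $i<j$. An atom $A$ is a procedure call in it iff $A$ is the first atom of some $Q_i$. An atom $A'$ is a procedure success (of the call $A$) iff $Q_i=A,\mathbf{B}$ for some $i\ge 0$, $Q_j=\mathbf{B}\theta_{i,j}$ for some $j>i$, and $A'=A\theta_{i,j}$ for the least such $j$. A program with a query is correct w.r.t. a pair $\langle\mathit{pre},\mathit{post}\rangle$ of sets of atoms closed under substitution iff in every LD-derivation for them all procedure calls are in $\mathit{pre}$ and all procedure successes are in $\mathit{post}$. -}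

module Defs where

open import Data.Nat using (ℕ; zero; suc; _<_; _≤_; _∸_; _+_)
open import Data.Bool using (Bool; true; false)
open import Data.Vec using (Vec; []; _∷_)
open import Data.List using (List; []; _∷_; _++_; map; concatMap; [_])
open import Data.List.Relation.Unary.All using (All)
open import Data.List.Relation.Unary.Any using (Any)
open import Data.List.Membership.Propositional using (_∈_)
open import Data.Product using (Σ; ∃; _×_; _,_)
open import Data.Sum using (_⊎_; inj₁; inj₂)
open import Relation.Binary.PropositionalEquality using (_≡_; _≢_)
open import Relation.Nullary using (¬_)
open import Function.Bundles using (_↔_; Inverse)

record Alphabet : Set₁ where
  field
    Fun    : Set
    farity : Fun → ℕ
    Pred   : Set
    parity : Pred → ℕ

-- Terms (depend only on the function symbols, so that the magic
-- alphabet has literally the same terms).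

data Term {F : Set} (ar : F → ℕ) : Set where
  var : ℕ → Term ar
  fn  : (f : F) → Vec (Term ar) (ar f) → Term ar

module _ {F : Set} {ar : F → ℕ} where

  Subst : Set
  Subst = ℕ → Term ar

  idS : Subst
  idS = var

  mutual
    _·t_ : Term ar → Subst → Term ar
    var x    ·t σ = σ x
    fn f ts  ·t σ = fn f (ts ·ts σ)

    _·ts_ : ∀ {n} → Vec (Term ar) n → Subst → Vec (Term ar) n
    []       ·ts σ = []
    (t ∷ ts) ·ts σ = (t ·t σ) ∷ (ts ·ts σ)

  -- composition: t ·t (σ ⨾ τ) = (t ·t σ) ·t τ   (first σ, then τ)
  _⨾_ : Subst → Subst → Subst
  (σ ⨾ τ) x = σ x ·t τ

  mutual
    data _occursIn_ (x : ℕ) : Term ar → Set where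
      here  : x occursIn var x
      under : ∀ {f ts} → x occursInVec ts → x occursIn fn f ts

    data _occursInVec_ (x : ℕ) : ∀ {n} → Vec (Term ar) n → Set where
      hd : ∀ {n t} {ts : Vec (Term ar) n} → x occursIn t → x occursInVec (t ∷ ts)
      tl : ∀ {n t} {ts : Vec (Term ar) n} → x occursInVec ts → x occursInVec (t ∷ ts)

  _∈varsS_ : ℕ → Subst → Set
  x ∈varsS σ = (σ x ≢ var x) ⊎ (∃ λ y → (σ y ≢ var y) × x occursIn σ y)

  ren : (ℕ ↔ ℕ) → Subst
  ren π x = var (Inverse.to π x)

module Over (L : Alphabet) where
  open Alphabet L

  Tm : Set
  Tm = Term farity

  Sub : Set
  Sub = Subst {ar = farity}

  record Atom : Set where
    constructor _⦅_⦆
    field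
      pred : Pred
      args : Vec Tm (parity pred)
  open Atom public

  _·a_ : Atom → Sub → Atom
  (p ⦅ ts ⦆) ·a σ = p ⦅ ts ·ts σ ⦆

  Query : Set
  Query = List Atom

  _·q_ : Query → Sub → Query
  Q ·q σ = map (λ A → A ·a σ) Q

  record Clause : Set where
    constructor _←_
    field
      head : Atom
      body : List Atom
  open Clause public

  _·c_ : Clause → Sub → Clause
  (H ← B) ·c σ = (H ·a σ) ← (B ·q σ)

  Program : Set
  Program = List Clause

  _∈varsA_ : ℕ → Atom → Set
  x ∈varsA A = x occursInVec (args A)

  _∈varsQ_ : ℕ → Query → Set
  x ∈varsQ Q = Any (λ A → x ∈varsA A) Q

  _∈varsC_ : ℕ → Clause → Set
  x ∈varsC c = (x ∈varsA head c) ⊎ (x ∈varsQ body c)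

  VariantIn : Program → Clause → Set
  VariantIn P c = ∃ λ c′ → (c′ ∈ P) × (∃ λ (π : ℕ ↔ ℕ) → c ≡ c′ ·c ren π)

  Unifier : Sub → Atom → Atom → Set
  Unifier θ A B = (A ·a θ) ≡ (B ·a θ)

  MGU : Sub → Atom → Atom → Set
  MGU θ A B = Unifier θ A B ×
              (∀ η → Unifier η A B → ∃ λ σ → ∀ x → η x ≡ (θ x ·t σ))

  -- A (finite) SLD-derivation for P and Q₀ with len steps:
  -- queries Q_0 … Q_len, input clauses c_1 … c_len (stored as input 0 …
  -- input (len-1)), mgu's θ_1 … θ_len (stored as mgu 1 … mgu len).  Values beyond len are
  -- irrelevant.
  record SLDDerivation (P : Program) (Q₀ : Query) : Set where
    field
      len      : ℕ
      query    : ℕ → Query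
      input    : ℕ → Clause
      mgu      : ℕ → Sub
      left     : ℕ → Query
      selected : ℕ → Atom
      right    : ℕ → Query
      start     : query 0 ≡ Q₀
      split     : ∀ i → i < len → query i ≡ left i ++ selected i ∷ right i
      variant   : ∀ i → i < len → VariantIn P (input i)
      unify     : ∀ i → i < len → MGU (mgu (suc i)) (selected i) (head (input i))
      resolvent : ∀ i → i < len →
                  query (suc i) ≡ (left i ++ body (input i) ++ right i) ·q mgu (suc i)
      apart     : ∀ i → i < len → ∀ x → x ∈varsC input i →
                  ¬ (x ∈varsQ Q₀) ×
                  (∀ k → k < i → ¬ (x ∈varsC input k) × ¬ (x ∈varsS mgu (suc k)))
  open SLDDerivation public

  IsLD : ∀ {P Q₀} → SLDDerivation P Q₀ → Set
  IsLD D = ∀ i → i < len D → left D i ≡ []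

  -- θs D i k = θ_{i+1} ⋯ θ_{i+k};  θ_{i,j} = θs D i (j ∸ i)
  θs : ∀ {P Q₀} → SLDDerivation P Q₀ → ℕ → ℕ → Sub
  θs D i zero    = idS
  θs D i (suc k) = θs D i k ⨾ mgu D (i + suc k)

  θ[_,_]_ : ∀ {P Q₀} → ℕ → ℕ → SLDDerivation P Q₀ → Sub
  θ[ i , j ] D = θs D i (j ∸ i)

  ProcCall : ∀ {P Q₀} → SLDDerivation P Q₀ → Atom → Set
  ProcCall D A = ∃ λ i → (i ≤ len D) × (∃ λ B → query D i ≡ A ∷ B)

  ProcSuccess : ∀ {P Q₀} → SLDDerivation P Q₀ → Atom → Atom → Set
  ProcSuccess D A A′ =
    ∃ λ i → ∃ λ j → ∃ λ B →
      (i < j) × (j ≤ len D) ×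
      (query D i ≡ A ∷ B) ×
      (query D j ≡ B ·q (θ[ i , j ] D)) ×
      (∀ k → i < k → k < j → query D k ≢ B ·q (θ[ i , k ] D)) ×
      (A′ ≡ A ·a (θ[ i , j ] D))

  Correct : ∀ {ℓ} → Program → Query → (Atom → Set ℓ) → (Atom → Set ℓ) → Set ℓ
  Correct P Q pre post =
    (D : SLDDerivation P Q) → IsLD D →
      (∀ A → ProcCall D A → pre A) × (∀ A A′ → ProcSuccess D A A′ → post A′)

  ComputedAnswer : Program → Atom → Atom → Set
  ComputedAnswer P Q A =
    ∃ λ (D : SLDDerivation P (Q ∷ [])) →
      (query D (len D) ≡ []) × (A ≡ Q ·a (θ[ 0 , len D ] D))

  record Interpretation : Set₁ where
    field
      Dom : Set
      d₀  : Dom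
      fI  : (f : Fun) → Vec Dom (farity f) → Dom
      pI  : (p : Pred) → Vec Dom (parity p) → Set

  module _ (I : Interpretation) where
    open Interpretation I
    mutual
      evalT : (ℕ → Dom) → Tm → Dom
      evalT ρ (var x)   = ρ x
      evalT ρ (fn f ts) = fI f (evalTs ρ ts)

      evalTs : ∀ {n} → (ℕ → Dom) → Vec Tm n → Vec Dom n
      evalTs ρ []       = []
      evalTs ρ (t ∷ ts) = evalT ρ t ∷ evalTs ρ ts

    TrueA : (ℕ → Dom) → Atom → Set
    TrueA ρ A = pI (pred A) (evalTs ρ (args A))

    TrueC : Clause → Set
    TrueC c = ∀ (ρ : ℕ → Dom) → All (TrueA ρ) (body c) → TrueA ρ (head c)

    IsModel : Program → Set
    IsModel P = All TrueC P

  _⊨_ : Program → Atom → Set₁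
  P ⊨ A = ∀ (I : Interpretation) → IsModel I P →
          ∀ (ρ : ℕ → Interpretation.Dom I) → TrueA I ρ A

-- a choice of argument positions i₁ < … < i_k of p, given as a
-- characteristic vector
Selection : Alphabet → Set
Selection L = (p : Alphabet.Pred L) → Vec Bool (Alphabet.parity L p)

count : ∀ {n} → Vec Bool n → ℕ
count []           = 0
count (true  ∷ s)  = suc (count s)
count (false ∷ s)  = count s

select : ∀ {A : Set} {n} (s : Vec Bool n) → Vec A n → Vec A (count s)
select []          []       = []
select (true  ∷ s) (x ∷ xs) = x ∷ select s xs
select (false ∷ s) (x ∷ xs) = select s xs

-- the extended alphabet: a new predicate p̂ = inj₂ p for each p
magicAlphabet : (L : Alphabet) → Selection L → Alphabet
magicAlphabet L sel = record
  { Fun    = Alphabet.Fun L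
  ; farity = Alphabet.farity L
  ; Pred   = Alphabet.Pred L ⊎ Alphabet.Pred L
  ; parity = ar′
  }
  where
  ar′ : Alphabet.Pred L ⊎ Alphabet.Pred L → ℕ
  ar′ (inj₁ p) = Alphabet.parity L p
  ar′ (inj₂ p) = count (sel p)

module Magic (L : Alphabet) (sel : Selection L) where
  module O = Over L
  module M = Over (magicAlphabet L sel)

  ↑_ : O.Atom → M.Atom
  ↑ (p O.⦅ ts ⦆) = inj₁ p M.⦅ ts ⦆

  hat : O.Atom → M.Atom
  hat (p O.⦅ ts ⦆) = inj₂ p M.⦅ select (sel p) ts ⦆

  -- clauses  B̂_i ← Ĥ, B_1, …, B_{i-1}   for i = 1 … n
  hatClauses : O.Atom → List M.Atom → List O.Atom → List M.Clause
  hatClauses H before []       = []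
  hatClauses H before (B ∷ Bs) =
    (hat B M.← (hat H ∷ before)) ∷ hatClauses H (before ++ [ ↑ B ]) Bs

  magicClause : O.Clause → List M.Clause
  magicClause (H O.← Bs) =
    ((↑ H) M.← (hat H ∷ map ↑_ Bs)) ∷ hatClauses H [] Bs

  magic : O.Program → O.Atom → M.Program
  magic P Q = (hat Q M.← []) ∷ concatMap magicClause P

  pre : O.Program → O.Atom → O.Atom → Set₁
  pre P Q A = magic P Q M.⊨ hat A

  post : O.Program → O.Atom → O.Atom → Set₁
  post P Q A = magic P Q M.⊨ (↑ A)

-- The clauses of magic(P,Q) are exactly the verification conditions for the specification
-- ⟨pre,post⟩: pre holds of Q, pre of a clause head together with post of the body atoms to the
-- left of B gives pre of B, and pre of the head with post of the whole body gives post of the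
-- head. Hence every query of an LD-derivation is well-asserted, and every call satisfies pre.
-- A procedure success or computed answer A is a logical consequence of P, and pre A holds.
-- Reading each p in a model of magic(P,Q) as "p̂ implies p" gives a model of P, in which A
-- holds; together with pre A this yields post A.

module Submission where

open import Defs
open import Data.List using ([]; _∷_)
open import Data.Product using (_×_)

open import Data.Bool using (Bool; true; false)
open import Data.Empty using (⊥-elim)
open import Data.List using (_++_; map; [_])
open import Data.List.Properties using (map-++; ++-assoc; ∷-injective; ++-identityˡ-unique)
open import Data.List.Membership.Propositional using (_∈_)
open import Data.List.Membership.Propositional.Properties using (∈-concatMap⁺)
open import Data.List.Relation.Unary.All as All using (All; []; _∷_)
open import Data.List.Relation.Unary.All.Properties using (++⁺; ++⁻; map⁺; map⁻)
open import Data.List.Relation.Unary.Any as Any using (here; there)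
open import Data.Nat using (ℕ; zero; suc; _+_; _∸_; _≤_; _<_; z<s)
open import Data.Nat.Properties using (+-suc; +-comm; m+n∸n≡m; m∸n+n≡m; m<n+m; <⇒≤; <-≤-trans; ≤-refl; ≤-reflexive)
open import Data.Product using (Σ; _,_; proj₁; proj₂)
open import Data.Sum using (inj₁; inj₂)
open import Data.Unit.Polymorphic using (⊤; tt)
open import Data.Vec using (Vec; []; _∷_)
open import Function using (_∘_; id)
open import Relation.Binary.PropositionalEquality
  using (_≡_; _≢_; refl; sym; trans; cong; cong₂; subst; subst₂; module ≡-Reasoning)

module _ {F : Set} {ar : F → ℕ} where

  mutual
    ·t-⨾ : (σ τ : Subst {ar = ar}) (t : Term ar) → (t ·t σ) ·t τ ≡ t ·t (σ ⨾ τ)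
    ·t-⨾ σ τ (var x)   = refl
    ·t-⨾ σ τ (fn f ts) = cong (fn f) (·ts-⨾ σ τ ts)

    ·ts-⨾ : (σ τ : Subst {ar = ar}) {n : ℕ} (ts : Vec (Term ar) n) →
            (ts ·ts σ) ·ts τ ≡ ts ·ts (σ ⨾ τ)
    ·ts-⨾ σ τ []       = refl
    ·ts-⨾ σ τ (t ∷ ts) = cong₂ _∷_ (·t-⨾ σ τ t) (·ts-⨾ σ τ ts)

  mutual
    ·t-idS : (t : Term ar) → t ·t idS ≡ t
    ·t-idS (var x)   = refl
    ·t-idS (fn f ts) = cong (fn f) (·ts-idS ts)

    ·ts-idS : {n : ℕ} (ts : Vec (Term ar) n) → ts ·ts idS ≡ ts
    ·ts-idS []       = refl
    ·ts-idS (t ∷ ts) = cong₂ _∷_ (·t-idS t) (·ts-idS ts)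

  select-·ts : {n : ℕ} (s : Vec Bool n) (ts : Vec (Term ar) n) (σ : Subst {ar = ar}) →
               select s (ts ·ts σ) ≡ select s ts ·ts σ
  select-·ts []          []       σ = refl
  select-·ts (true  ∷ s) (t ∷ ts) σ = cong (t ·t σ ∷_) (select-·ts s ts σ)
  select-·ts (false ∷ s) (t ∷ ts) σ = select-·ts s ts σ

module Properties (L : Alphabet) where
  open Over L

  ·a-⨾ : (A : Atom) (σ τ : Sub) → (A ·a σ) ·a τ ≡ A ·a (σ ⨾ τ)
  ·a-⨾ (p ⦅ ts ⦆) σ τ = cong (p ⦅_⦆) (·ts-⨾ σ τ ts)

  ·a-idS : (A : Atom) → A ·a idS ≡ A
  ·a-idS (p ⦅ ts ⦆) = cong (p ⦅_⦆) (·ts-idS ts)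

  ·q-⨾ : (C : Query) (σ τ : Sub) → (C ·q σ) ·q τ ≡ C ·q (σ ⨾ τ)
  ·q-⨾ []      σ τ = refl
  ·q-⨾ (A ∷ C) σ τ = cong₂ _∷_ (·a-⨾ A σ τ) (·q-⨾ C σ τ)

  ·q-idS : (C : Query) → C ·q idS ≡ C
  ·q-idS []      = refl
  ·q-idS (A ∷ C) = cong₂ _∷_ (·a-idS A) (·q-idS C)

  ·q-++ : (C C′ : Query) (σ : Sub) → (C ++ C′) ·q σ ≡ C ·q σ ++ C′ ·q σ
  ·q-++ C C′ σ = map-++ (_·a σ) C C′

  module _ (I : Interpretation) where
    open Interpretation I

    mutual
      evalT-·t : (ρ : ℕ → Dom) (σ : Sub) (t : Tm) → evalT I ρ (t ·t σ) ≡ evalT I (evalT I ρ ∘ σ) t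
      evalT-·t ρ σ (var x)   = refl
      evalT-·t ρ σ (fn f ts) = cong (fI f) (evalTs-·ts ρ σ ts)

      evalTs-·ts : (ρ : ℕ → Dom) (σ : Sub) {n : ℕ} (ts : Vec Tm n) →
                   evalTs I ρ (ts ·ts σ) ≡ evalTs I (evalT I ρ ∘ σ) ts
      evalTs-·ts ρ σ []       = refl
      evalTs-·ts ρ σ (t ∷ ts) = cong₂ _∷_ (evalT-·t ρ σ t) (evalTs-·ts ρ σ ts)

    TrueA-·a : (ρ : ℕ → Dom) (σ : Sub) (A : Atom) → TrueA I ρ (A ·a σ) ≡ TrueA I (evalT I ρ ∘ σ) A
    TrueA-·a ρ σ (p ⦅ ts ⦆) = cong (pI p) (evalTs-·ts ρ σ ts)

    All-TrueA-·q⁻ : (ρ : ℕ → Dom) (σ : Sub) {C : Query} →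
                    All (TrueA I ρ) (C ·q σ) → All (TrueA I (evalT I ρ ∘ σ)) C
    All-TrueA-·q⁻ ρ σ = All.map (λ {A} → subst id (TrueA-·a ρ σ A)) ∘ map⁻

    All-TrueA-·q⁺ : (ρ : ℕ → Dom) (σ : Sub) {C : Query} →
                    All (TrueA I (evalT I ρ ∘ σ)) C → All (TrueA I ρ) (C ·q σ)
    All-TrueA-·q⁺ ρ σ = map⁺ ∘ All.map (λ {A} → subst id (sym (TrueA-·a ρ σ A)))

  infix 4 _⊨_⟶_

  _⊨_⟶_ : Program → Query → Query → Set₁
  P ⊨ C ⟶ C′ = (I : Interpretation) → IsModel I P → (ρ : ℕ → Interpretation.Dom I) →
               All (TrueA I ρ) C → All (TrueA I ρ) C′

  module _ {P : Program} where

    ⟶-refl : {C : Query} → P ⊨ C ⟶ C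
    ⟶-refl I _ ρ = id

    ⟶-trans : {C C′ C″ : Query} → P ⊨ C ⟶ C′ → P ⊨ C′ ⟶ C″ → P ⊨ C ⟶ C″
    ⟶-trans e e′ I m ρ = e′ I m ρ ∘ e I m ρ

    ⟶-++ : {C₁ C₁′ C₂ C₂′ : Query} → P ⊨ C₁ ⟶ C₁′ → P ⊨ C₂ ⟶ C₂′ → P ⊨ C₁ ++ C₂ ⟶ C₁′ ++ C₂′
    ⟶-++ {C₁} e₁ e₂ I m ρ h = ++⁺ (e₁ I m ρ (proj₁ (++⁻ C₁ h))) (e₂ I m ρ (proj₂ (++⁻ C₁ h)))

    ⟶-·q : {C C′ : Query} (σ : Sub) → P ⊨ C ⟶ C′ → P ⊨ C ·q σ ⟶ C′ ·q σ
    ⟶-·q σ e I m ρ = All-TrueA-·q⁺ I ρ σ ∘ e I m (evalT I ρ ∘ σ) ∘ All-TrueA-·q⁻ I ρ σ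

    ⟶⇒⊨ : {A : Atom} → P ⊨ [] ⟶ [ A ] → P ⊨ A
    ⟶⇒⊨ e I m ρ = All.head (e I m ρ [])

    ∈⇒⊨ : {c : Clause} → c ∈ P → (σ : Sub) → P ⊨ body c ·q σ ⟶ [ head c ·a σ ]
    ∈⇒⊨ {c} c∈P σ I m ρ h =
      subst id (sym (TrueA-·a I ρ σ (head c))) (All.lookup m c∈P _ (All-TrueA-·q⁻ I ρ σ h)) ∷ []

    variant⇒⊨ : {c : Clause} → VariantIn P c → (σ : Sub) → P ⊨ body c ·q σ ⟶ [ head c ·a σ ]
    variant⇒⊨ (c , c∈P , π , refl) σ
      rewrite ·q-⨾ (body c) (ren π) σ | ·a-⨾ (head c) (ren π) σ = ∈⇒⊨ c∈P (ren π ⨾ σ)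

    ⊨-clause : {c : Clause} → c ∈ P → (σ : Sub) → All (λ B → P ⊨ (B ·a σ)) (body c) → P ⊨ (head c ·a σ)
    ⊨-clause c∈P σ hs I m ρ = All.head (∈⇒⊨ c∈P σ I m ρ (map⁺ (All.map (λ h → h I m ρ) hs)))

  module _ {P : Program} {Q₀ : Query} (D : SLDDerivation P Q₀) where

    resolvent-sound : (k : ℕ) → k < len D →
                      P ⊨ body (input D k) ·q mgu D (suc k) ⟶ [ selected D k ·a mgu D (suc k) ]
    resolvent-sound k k<len rewrite proj₁ (unify D k k<len) =
      variant⇒⊨ (variant D k k<len) (mgu D (suc k))

    step-sound : (k : ℕ) → k < len D → P ⊨ query D (suc k) ⟶ query D k ·q mgu D (suc k)
    step-sound k k<len
      rewrite resolvent D k k<len | split D k k<len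
            | ·q-++ (left D k) (body (input D k) ++ right D k) (mgu D (suc k))
            | ·q-++ (left D k) (selected D k ∷ right D k) (mgu D (suc k))
            | ·q-++ (body (input D k)) (right D k) (mgu D (suc k)) =
      ⟶-++ ⟶-refl (⟶-++ (resolvent-sound k k<len) ⟶-refl)

    query-sound : (k : ℕ) → k ≤ len D → P ⊨ query D k ⟶ Q₀ ·q θs D 0 k
    query-sound zero _ rewrite start D | ·q-idS Q₀ = ⟶-refl
    query-sound (suc k) k<len =
      subst (P ⊨ query D (suc k) ⟶_) (·q-⨾ Q₀ (θs D 0 k) (mgu D (suc k)))
        (⟶-trans (step-sound k k<len) (⟶-·q (mgu D (suc k)) (query-sound k (<⇒≤ k<len))))

  computedAnswer-sound : {P : Program} {Q A : Atom} → ComputedAnswer P Q A → P ⊨ A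
  computedAnswer-sound {P} {Q} (D , done , refl) =
    ⟶⇒⊨ (subst (P ⊨_⟶ [ Q ·a θs D 0 (len D) ]) done (query-sound D (len D) ≤-refl))

  module _ {P : Program} {Q₀ : Query} (D : SLDDerivation P Q₀) (ld : IsLD D) where

    ld-split : (k : ℕ) → k < len D → query D k ≡ selected D k ∷ right D k
    ld-split k k<len rewrite split D k k<len | ld k k<len = refl

    ld-resolvent : (k : ℕ) → k < len D →
                   query D (suc k) ≡ body (input D k) ·q mgu D (suc k) ++ right D k ·q mgu D (suc k)
    ld-resolvent k k<len rewrite resolvent D k k<len | ld k k<len =
      ·q-++ (body (input D k)) (right D k) (mgu D (suc k))

    -- Until the call A of A ∷ B returns, LD-resolution only rewrites the goals C that stem
    -- from A, while B is merely instantiated.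
    module LDCall {i : ℕ} {A : Atom} {B : Query} (call : query D i ≡ A ∷ B) where

      θ : ℕ → Sub
      θ = θs D i

      θ-suc : (m : ℕ) → θ (suc m) ≡ θ m ⨾ mgu D (suc (m + i))
      θ-suc m = cong (λ n → θ m ⨾ mgu D n) (trans (+-suc i m) (cong suc (+-comm i m)))

      Pending : ℕ → Set₁
      Pending m = Σ Query λ C → (query D (m + i) ≡ C ++ B ·q θ m) × (P ⊨ C ⟶ [ A ·a θ m ])

      pending-start : Pending 0
      pending-start =
        [ A ] , trans call (cong (A ∷_) (sym (·q-idS B))) ,
        subst (λ A′ → P ⊨ [ A ] ⟶ [ A′ ]) (sym (·a-idS A)) ⟶-refl

      pending-step : (m : ℕ) → m + i < len D → query D (m + i) ≢ B ·q θ m →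
                     Pending m → Pending (suc m)
      pending-step m _ returned ([] , eq , _) = ⊥-elim (returned eq)
      pending-step m k<len _ (S ∷ C , eq , S∷C⟶A) = bodyτ ++ C ·q τ , query-eq , entail
        where
        k = m + i
        τ = mgu D (suc k)
        bodyτ = body (input D k) ·q τ
        selected-eq : S ∷ C ++ B ·q θ m ≡ selected D k ∷ right D k
        selected-eq = trans (sym eq) (ld-split k k<len)
        open ≡-Reasoning
        query-eq : query D (suc k) ≡ (bodyτ ++ C ·q τ) ++ B ·q θ (suc m)
        query-eq = begin
          query D (suc k)                         ≡⟨ ld-resolvent k k<len ⟩
          bodyτ ++ right D k ·q τ                 ≡⟨ cong (λ R → bodyτ ++ R ·q τ) (sym (proj₂ (∷-injective selected-eq))) ⟩
          bodyτ ++ (C ++ B ·q θ m) ·q τ           ≡⟨ cong (bodyτ ++_) (·q-++ C (B ·q θ m) τ) ⟩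
          bodyτ ++ C ·q τ ++ (B ·q θ m) ·q τ      ≡⟨ sym (++-assoc bodyτ (C ·q τ) _) ⟩
          (bodyτ ++ C ·q τ) ++ (B ·q θ m) ·q τ    ≡⟨ cong ((bodyτ ++ C ·q τ) ++_) (·q-⨾ B (θ m) τ) ⟩
          (bodyτ ++ C ·q τ) ++ B ·q (θ m ⨾ τ)     ≡⟨ cong (λ σ → (bodyτ ++ C ·q τ) ++ B ·q σ) (sym (θ-suc m)) ⟩
          (bodyτ ++ C ·q τ) ++ B ·q θ (suc m)     ∎
        entail : P ⊨ bodyτ ++ C ·q τ ⟶ [ A ·a θ (suc m) ]
        entail = ⟶-trans (⟶-++ (resolvent-sound D k k<len) ⟶-refl)
          (subst₂ (P ⊨_⟶_)
            (cong (λ S′ → S′ ·a τ ∷ C ·q τ) (proj₁ (∷-injective selected-eq)))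
            (cong [_] (trans (·a-⨾ A (θ m) τ) (cong (A ·a_) (sym (θ-suc m)))))
            (⟶-·q τ S∷C⟶A))

    success-sound : {A A′ : Atom} → ProcSuccess D A A′ → P ⊨ A′
    success-sound {A} (i , j , B , i<j , j≤len , call , return , first-return , refl) =
      returned (pending (j ∸ i) (≤-reflexive j∸i+i≡j))
      where
      open LDCall call

      j∸i+i≡j : j ∸ i + i ≡ j
      j∸i+i≡j = m∸n+n≡m (<⇒≤ i<j)

      not-returned : (m : ℕ) → m + i < j → query D (m + i) ≢ B ·q θ m
      not-returned zero _ eq with ++-identityˡ-unique [ A ] (trans (sym (·q-idS B)) (trans (sym eq) call))
      ... | ()
      not-returned (suc m) lt eq =
        first-return (suc m + i) (m<n+m i z<s) lt
          (trans eq (cong (λ n → B ·q θ n) (sym (m+n∸n≡m (suc m) i))))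

      pending : (m : ℕ) → m + i ≤ j → Pending m
      pending zero    _  = pending-start
      pending (suc m) lt =
        pending-step m (<-≤-trans lt j≤len) (not-returned m lt) (pending m (<⇒≤ lt))

      returned : Pending (j ∸ i) → P ⊨ (A ·a θ (j ∸ i))
      returned (C , eq , C⟶A) = ⟶⇒⊨ (subst (P ⊨_⟶ [ A ·a θ (j ∸ i) ]) C≡[] C⟶A)
        where
        C≡[] : C ≡ []
        C≡[] = ++-identityˡ-unique C (trans (sym (trans (cong (query D) j∸i+i≡j) return)) eq)

module MagicCorrectness (L : Alphabet) (sel : Selection L) (P : Over.Program L) (Q : Over.Atom L) where
  open Over L
  open Properties L
  open Magic L sel
  module MP = Properties (magicAlphabet L sel)

  magicP : M.Program
  magicP = magic P Q

  Pre Post : Atom → Set₁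
  Pre  = pre P Q
  Post = post P Q

  hat-·a : (A : Atom) (σ : Sub) → hat (A ·a σ) ≡ hat A M.·a σ
  hat-·a (p ⦅ ts ⦆) σ = cong (inj₂ p M.⦅_⦆) (select-·ts (sel p) ts σ)

  magicClause⊆magic : {c : Clause} → c ∈ P → {c̃ : M.Clause} → c̃ ∈ magicClause c → c̃ ∈ magicP
  magicClause⊆magic c∈P c̃∈ = there (∈-concatMap⁺ magicClause (Any.map (λ { refl → c̃∈ }) c∈P))

  pre-query : (σ : Sub) → Pre (Q ·a σ)
  pre-query σ = subst (magicP M.⊨_) (sym (hat-·a Q σ)) (MP.⊨-clause (here refl) σ [])

  AllPost : Sub → Query → Set₁
  AllPost σ C = All (λ A → Post (A ·a σ)) C

  AllPost-·q : (σ τ : Sub) (C : Query) → AllPost σ (C ·q τ) → AllPost (τ ⨾ σ) C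
  AllPost-·q σ τ C = All.map (λ {A} → subst Post (·a-⨾ A τ σ)) ∘ map⁻

  -- Every instance σ satisfying Γ, in which the atoms to the left of A satisfy post,
  -- makes A satisfy pre.
  WellAsserted : (Sub → Set₁) → Query → Set₁
  WellAsserted Γ []      = ⊤
  WellAsserted Γ (A ∷ C) =
    ((σ : Sub) → Γ σ → Pre (A ·a σ)) × WellAsserted (λ σ → Γ σ × Post (A ·a σ)) C

  wellAsserted-weaken : {Γ Γ′ : Sub → Set₁} → ((σ : Sub) → Γ′ σ → Γ σ) →
                        (C : Query) → WellAsserted Γ C → WellAsserted Γ′ C
  wellAsserted-weaken f []      _       = tt
  wellAsserted-weaken f (A ∷ C) (h , w) =
    (λ σ → h σ ∘ f σ) , wellAsserted-weaken (λ σ (γ , post) → f σ γ , post) C w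

  wellAsserted-++ : {Γ : Sub → Set₁} (C : Query) {C′ : Query} → WellAsserted Γ C →
                    WellAsserted (λ σ → Γ σ × AllPost σ C) C′ → WellAsserted Γ (C ++ C′)
  wellAsserted-++ []      {C′} _       w′ = wellAsserted-weaken (λ σ γ → γ , []) C′ w′
  wellAsserted-++ (A ∷ C) {C′} (h , w) w′ =
    h , wellAsserted-++ C w (wellAsserted-weaken (λ σ ((γ , post) , posts) → γ , post ∷ posts) C′ w′)

  wellAsserted-·q : {Γ Γ′ : Sub → Set₁} (τ : Sub) → ((σ : Sub) → Γ σ → Γ′ (τ ⨾ σ)) →
                    (C : Query) → WellAsserted Γ′ C → WellAsserted Γ (C ·q τ)
  wellAsserted-·q τ f []      _       = tt
  wellAsserted-·q τ f (A ∷ C) (h , w) =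
    (λ σ γ → subst Pre (sym (·a-⨾ A τ σ)) (h (τ ⨾ σ) (f σ γ))) ,
    wellAsserted-·q τ (λ σ (γ , post) → f σ γ , subst Post (·a-⨾ A τ σ) post) C w

  hat-body : (H : Atom) (X Bs : Query) →
             ({c̃ : M.Clause} → c̃ ∈ hatClauses H (map ↑_ X) Bs → c̃ ∈ magicP) →
             WellAsserted (λ σ → Pre (H ·a σ) × AllPost σ X) Bs
  hat-body H X []       _       = tt
  hat-body H X (B ∷ Bs) ⊆magicP =
    pre-B ,
    wellAsserted-weaken (λ σ ((preH , posts) , post) → preH , ++⁺ posts (post ∷ [])) Bs
      (hat-body H (X ++ [ B ]) Bs (⊆magicP ∘ there ∘ subst (λ X̃ → _ ∈ hatClauses H X̃ Bs) (map-++ ↑_ X [ B ])))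
    where
    pre-B : (σ : Sub) → Pre (H ·a σ) × AllPost σ X → Pre (B ·a σ)
    pre-B σ (preH , posts) =
      subst (magicP M.⊨_) (sym (hat-·a B σ))
        (MP.⊨-clause (⊆magicP (here refl)) σ (subst (magicP M.⊨_) (hat-·a H σ) preH ∷ map⁺ posts))

  pre-body : {c : Clause} → c ∈ P → WellAsserted (λ σ → Pre (head c ·a σ)) (body c)
  pre-body {c} c∈P =
    wellAsserted-weaken (λ σ preH → preH , []) (body c)
      (hat-body (head c) [] (body c) (magicClause⊆magic c∈P ∘ there))

  post-head : {c : Clause} → c ∈ P → (σ : Sub) →
              Pre (head c ·a σ) → AllPost σ (body c) → Post (head c ·a σ)
  post-head {c} c∈P σ preH posts =
    MP.⊨-clause (magicClause⊆magic c∈P (here refl)) σ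
      (subst (magicP M.⊨_) (hat-·a (head c) σ) preH ∷ map⁺ posts)

  variant-pre-body : {c : Clause} → VariantIn P c → WellAsserted (λ σ → Pre (head c ·a σ)) (body c)
  variant-pre-body (c , c∈P , π , refl) =
    wellAsserted-·q (ren π) (λ σ → subst Pre (·a-⨾ (head c) (ren π) σ)) (body c) (pre-body c∈P)

  variant-post-head : {c : Clause} → VariantIn P c → (σ : Sub) →
                      Pre (head c ·a σ) → AllPost σ (body c) → Post (head c ·a σ)
  variant-post-head (c , c∈P , π , refl) σ preH posts =
    subst Post (sym (·a-⨾ (head c) (ren π) σ))
      (post-head c∈P (ren π ⨾ σ) (subst Pre (·a-⨾ (head c) (ren π) σ) preH)
        (AllPost-·q σ (ren π) (body c) posts))

  ld-query-wellAsserted : (D : SLDDerivation P [ Q ]) → IsLD D →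
                          (k : ℕ) → k ≤ len D → WellAsserted (λ _ → ⊤) (query D k)
  ld-query-wellAsserted D ld zero _ =
    subst (WellAsserted (λ _ → ⊤)) (sym (start D)) ((λ σ _ → pre-query σ) , tt)
  ld-query-wellAsserted D ld (suc k) k<len =
    subst (WellAsserted (λ _ → ⊤)) (sym (ld-resolvent D ld k k<len))
      (wellAsserted-++ (body c ·q τ) body-asserted
        (wellAsserted-·q τ right-context (right D k) (proj₂ selected-asserted)))
    where
    c = input D k
    τ = mgu D (suc k)
    S = selected D k

    selected-asserted : WellAsserted (λ _ → ⊤) (S ∷ right D k)
    selected-asserted =
      subst (WellAsserted (λ _ → ⊤)) (ld-split D ld k k<len) (ld-query-wellAsserted D ld k (<⇒≤ k<len))

    S≈head : (σ : Sub) → S ·a (τ ⨾ σ) ≡ head c ·a (τ ⨾ σ)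
    S≈head σ = trans (sym (·a-⨾ S τ σ))
                 (trans (cong (_·a σ) (proj₁ (unify D k k<len))) (·a-⨾ (head c) τ σ))

    pre-head : (σ : Sub) → Pre (head c ·a (τ ⨾ σ))
    pre-head σ = subst Pre (S≈head σ) (proj₁ selected-asserted (τ ⨾ σ) tt)

    body-asserted : WellAsserted (λ _ → ⊤) (body c ·q τ)
    body-asserted = wellAsserted-·q τ (λ σ _ → pre-head σ) (body c) (variant-pre-body (variant D k k<len))

    right-context : (σ : Sub) → ⊤ × AllPost σ (body c ·q τ) → ⊤ × Post (S ·a (τ ⨾ σ))
    right-context σ (_ , posts) =
      tt , subst Post (sym (S≈head σ))
             (variant-post-head (variant D k k<len) (τ ⨾ σ) (pre-head σ) (AllPost-·q σ τ (body c) posts))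

  ld-call-pre : (D : SLDDerivation P [ Q ]) → IsLD D → {i : ℕ} → i ≤ len D →
                {A : Atom} {B : Query} → query D i ≡ A ∷ B → (σ : Sub) → Pre (A ·a σ)
  ld-call-pre D ld i≤len call σ =
    proj₁ (subst (WellAsserted (λ _ → ⊤)) call (ld-query-wellAsserted D ld _ i≤len)) σ tt

  relativise : M.Interpretation → Interpretation
  relativise I = record
    { Dom = Dom ; d₀ = d₀ ; fI = fI
    ; pI  = λ p ds → pI (inj₂ p) (select (sel p) ds) → pI (inj₁ p) ds
    }
    where open M.Interpretation I

  module _ (I : M.Interpretation) (ρ : ℕ → M.Interpretation.Dom I) where
    open M.Interpretation I

    mutual
      evalT-relativise : (t : Tm) → evalT (relativise I) ρ t ≡ M.evalT I ρ t
      evalT-relativise (var x)   = refl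
      evalT-relativise (fn f ts) = cong (fI f) (evalTs-relativise ts)

      evalTs-relativise : {n : ℕ} (ts : Vec Tm n) → evalTs (relativise I) ρ ts ≡ M.evalTs I ρ ts
      evalTs-relativise []       = refl
      evalTs-relativise (t ∷ ts) = cong₂ _∷_ (evalT-relativise t) (evalTs-relativise ts)

    evalTs-select : {n : ℕ} (s : Vec Bool n) (ts : Vec Tm n) →
                    M.evalTs I ρ (select s ts) ≡ select s (M.evalTs I ρ ts)
    evalTs-select []          []       = refl
    evalTs-select (true  ∷ s) (t ∷ ts) = cong (M.evalT I ρ t ∷_) (evalTs-select s ts)
    evalTs-select (false ∷ s) (t ∷ ts) = evalTs-select s ts

    TrueA-relativise : (A : Atom) →
                       TrueA (relativise I) ρ A ≡ (M.TrueA I ρ (hat A) → M.TrueA I ρ (↑ A))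
    TrueA-relativise (p ⦅ ts ⦆) =
      cong₂ (λ ds̃ ds → pI (inj₂ p) ds̃ → pI (inj₁ p) ds)
        (trans (cong (select (sel p)) (evalTs-relativise ts)) (sym (evalTs-select (sel p) ts)))
        (evalTs-relativise ts)

    ↑-body-true : (H : Atom) (X Bs : Query) →
                  ({c̃ : M.Clause} → c̃ ∈ hatClauses H (map ↑_ X) Bs → M.TrueC I c̃) →
                  M.TrueA I ρ (hat H) → All (M.TrueA I ρ ∘ ↑_) X →
                  All (TrueA (relativise I) ρ) Bs → All (M.TrueA I ρ ∘ ↑_) Bs
    ↑-body-true H X []       _      _    _       []         = []
    ↑-body-true H X (B ∷ Bs) ⊨hatCs hatH ↑X-true (B-true ∷ Bs-true) =
      ↑B-true ∷ ↑-body-true H (X ++ [ B ]) Bs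
                  (⊨hatCs ∘ there ∘ subst (λ X̃ → _ ∈ hatClauses H X̃ Bs) (map-++ ↑_ X [ B ]))
                  hatH (++⁺ ↑X-true (↑B-true ∷ [])) Bs-true
      where
      ↑B-true : M.TrueA I ρ (↑ B)
      ↑B-true = subst id (TrueA-relativise B) B-true (⊨hatCs (here refl) ρ (hatH ∷ map⁺ ↑X-true))

  relativise-model : (I : M.Interpretation) → M.IsModel I magicP → IsModel (relativise I) P
  relativise-model I model = All.tabulate clause-true
    where
    clause-true : {c : Clause} → c ∈ P → TrueC (relativise I) c
    clause-true {c} c∈P ρ body-true = subst id (sym (TrueA-relativise I ρ (head c))) λ hatH →
      All.lookup model (magicClause⊆magic c∈P (here refl)) ρ
        (hatH ∷ map⁺ (↑-body-true I ρ (head c) [] (body c)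
                        (All.lookup model ∘ magicClause⊆magic c∈P ∘ there) hatH [] body-true))

  pre×⊨⇒post : {A : Atom} → Pre A → P ⊨ A → Post A
  pre×⊨⇒post {A} preA ⊨A I model ρ =
    subst id (TrueA-relativise I ρ A) (⊨A (relativise I) (relativise-model I model) ρ) (preA I model ρ)

lemma2 : (L : Alphabet) (sel : Selection L)
         (P : Over.Program L) (Q : Over.Atom L) →
         Over.Correct L P (Q ∷ []) (Magic.pre L sel P Q) (Magic.post L sel P Q)
         × (∀ A → Over.ComputedAnswer L P Q A → Magic.post L sel P Q A)
lemma2 L sel P Q = correct , answers
  where
  open Over L
  open Properties L
  open MagicCorrectness L sel P Q

  correct : Correct P [ Q ] Pre Post
  correct D ld = calls , successes
    where
    calls : (A : Atom) → ProcCall D A → Pre A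
    calls A (i , i≤len , B , call) = subst Pre (·a-idS A) (ld-call-pre D ld i≤len call idS)

    successes : (A A′ : Atom) → ProcSuccess D A A′ → Post A′
    successes A A′ success@(i , j , B , i<j , j≤len , call , _ , _ , refl) =
      pre×⊨⇒post (ld-call-pre D ld (<⇒≤ (<-≤-trans i<j j≤len)) call _) (success-sound D ld success)

  answers : (A : Atom) → ComputedAnswer P Q A → Post A
  answers A answer@(_ , _ , refl) = pre×⊨⇒post (pre-query _) (computedAnswer-sound answer)
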